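{- Let $j\in\mathbb{N}$. For every $n\in\mathbb{N}$, \[ \frac{1}{n}\sum_{k=1}^{n}\gcd(k^j,n)=\sum_{d\mid n}\frac{\phi(d)\,N^{(j)}(d)}{d}, \] where $N^{(j)}$ is the multiplicative arithmetical function determined by $N^{(j)}(p^a)=p^{\lfloor (j-1)a/j\rfloor}$ for every prime $p$ and every $a\in\mathbb{N}$.
   Context: $\mathbb{N}=\{1,2,\ldots\}$; $\phi$ is Euler's totient function; $\lfloor y\rfloor$ is the greatest integer $\le y$. A multiplicative function $f$ satisfies $f(1)=1$ and $f(ab)=f(a)f(b)$ whenever $\gcd(a,b)=1$. -}

module Defs where

open import Data.Nat using (ℕ; zero; suc; _+_; _*_; _≤_; NonZero)
open import Data.Nat.Coprimality using (Coprime; coprime?)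
open import Data.Nat.Divisibility using (_∣?_)
open import Relation.Nullary.Decidable using (⌊_⌋)
open import Data.Bool using (if_then_else_)
open import Data.Integer using (+_)
open import Data.Rational as ℚ using (ℚ; 0ℚ)
open import Relation.Binary.PropositionalEquality using (_≡_)

countCoprime : ℕ → ℕ → ℕ
countCoprime zero    d = 0
countCoprime (suc k) d = countCoprime k d + (if ⌊ coprime? (suc k) d ⌋ then 1 else 0)

φ : ℕ → ℕ
φ d = countCoprime d d

Σ[1‥_] : ℕ → ((k : ℕ) → .{{NonZero k}} → ℚ) → ℚ
Σ[1‥ zero ]  f = 0ℚ
Σ[1‥ suc n ] f = Σ[1‥ n ] f ℚ.+ f (suc n)

-- Σ_{d ∣ n} f d  (for n ≥ 1, divisors lie in 1..n)
Σ-divisors : ℕ → ((d : ℕ) → .{{NonZero d}} → ℚ) → ℚ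
Σ-divisors n f = Σ[1‥ n ] (λ d → if ⌊ d ∣? n ⌋ then f d else 0ℚ)

IsMultiplicative : (ℕ → ℕ) → Set
IsMultiplicative f =
  (f 1 ≡ 1) × (∀ a b → 1 ≤ a → 1 ≤ b → Coprime a b → f (a * b) ≡ f a * f b)
  where open import Data.Product using (_×_)

module Submission where

-- The proof combines three independent ingredients, developed in this order.
-- (1) Gauss's identity Σ_{d ∣ m} φ(d) = m, obtained by sorting 1 ≤ k ≤ m by the
--     value of gcd(k, m).  Applied to m = gcd(x, n) it gives
--     gcd(x, n) = Σ_{d ∣ n, d ∣ x} φ(d), and summing over x = k^j yields
--     Σ_k gcd(k^j, n) = Σ_{d ∣ n} φ(d) · #{1 ≤ k ≤ n : d ∣ k^j}.
-- (2) Root moduli: r is a j-th root modulus of d when d ∣ k^j ⇔ r ∣ k.  For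
--     d = p^a the modulus is p^⌈a/j⌉, where ⌈a/j⌉ = a − ⌊(j−1)a/j⌋, so that
--     p^⌈a/j⌉ · N(p^a) = p^a.  Root moduli of coprime numbers multiply, and so
--     does N; strong induction (splitting off a maximal prime power) gives, for
--     every d ≥ 1, a root modulus r with r · N(d) = d.
-- (3) Hence for d ∣ n the count #{k ≤ n : d ∣ k^j} = #{k ≤ n : r ∣ k} equals
--     N(d) · n/d, which turns (1) into the theorem.

open import Defs
open import Data.Nat
open import Data.Nat.Properties
open import Data.Nat.DivMod using (/-monoˡ-≤; m*n/n≡m; m/n*n≤m)
open import Data.Nat.Divisibility
open import Data.Nat.GCD using (gcd; gcd[m,n]∣m; gcd[m,n]∣n; gcd-greatest; gcd[m,n]≢0; gcd[m,n]≤n; c*gcd[m,n]≡gcd[cm,cn])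
open import Data.Nat.Coprimality using (Coprime; coprime?; coprime-divisor; gcd≡1⇒coprime; coprime⇒gcd≡1)
open import Data.Nat.Primality using (Prime; euclidsLemma; prime⇒irreducible; prime⇒nonZero; prime⇒nonTrivial)
open import Data.Nat.Primality.Factorisation using (factorise)
open import Data.Nat.Induction using (<-rec)
open import Data.Nat.Tactic.RingSolver using (solve-∀)
open import Data.List using ([]; _∷_)
open import Data.List.Relation.Unary.All using (_∷_)
open import Data.Nat.ListAction using (product)
open import Data.Integer as ℤ using (+_)
import Data.Integer.Properties as ℤ
open import Data.Integer.Tactic.RingSolver as ℤ-Solver using ()
open import Data.Rational as ℚ using (ℚ; 0ℚ; toℚᵘ)
import Data.Rational.Properties as ℚ
open import Data.Rational.Unnormalised as ℚᵘ using (mkℚᵘ; *≡*)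
import Data.Rational.Unnormalised.Properties as ℚᵘ
open import Data.Bool using (if_then_else_)
open import Data.Empty using (⊥-elim)
open import Data.Sum using (inj₁; inj₂)
open import Data.Product using (Σ; _×_; _,_; proj₁; proj₂)
open import Relation.Nullary using (Dec; yes; no; ¬_)
open import Relation.Nullary.Decidable using (⌊_⌋)
open import Relation.Binary.PropositionalEquality

cofactor≥1 : ∀ {m} q e → 1 ≤ m → m ≡ q * e → 1 ≤ q
cofactor≥1 zero    e m≥1 m≡0 = ⊥-elim (<⇒≢ m≥1 (sym m≡0))
cofactor≥1 (suc q) e _   _   = s≤s z≤n

sumTo : ℕ → (ℕ → ℕ) → ℕ
sumTo zero    f = 0
sumTo (suc n) f = sumTo n f + f (suc n)

sumTo-cong : ∀ n {f g : ℕ → ℕ} → (∀ k → 1 ≤ k → k ≤ n → f k ≡ g k) → sumTo n f ≡ sumTo n g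
sumTo-cong zero    eq = refl
sumTo-cong (suc n) eq =
  cong₂ _+_ (sumTo-cong n (λ k 1≤k k≤n → eq k 1≤k (m≤n⇒m≤1+n k≤n))) (eq (suc n) (s≤s z≤n) ≤-refl)

sumTo-zero : ∀ n {f : ℕ → ℕ} → (∀ k → 1 ≤ k → k ≤ n → f k ≡ 0) → sumTo n f ≡ 0
sumTo-zero zero    eq = refl
sumTo-zero (suc n) eq =
  cong₂ _+_ (sumTo-zero n (λ k 1≤k k≤n → eq k 1≤k (m≤n⇒m≤1+n k≤n))) (eq (suc n) (s≤s z≤n) ≤-refl)

sumTo-ones : ∀ n → sumTo n (λ _ → 1) ≡ n
sumTo-ones zero    = refl
sumTo-ones (suc n) = trans (cong (_+ 1) (sumTo-ones n)) (+-comm n 1)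

sumTo-+ : ∀ n (f g : ℕ → ℕ) → sumTo n (λ k → f k + g k) ≡ sumTo n f + sumTo n g
sumTo-+ zero    f g = refl
sumTo-+ (suc n) f g =
  trans (cong (_+ (f (suc n) + g (suc n))) (sumTo-+ n f g)) (interchange (sumTo n f) (sumTo n g) (f (suc n)) (g (suc n)))
  where
  interchange : ∀ a b c d → a + b + (c + d) ≡ a + c + (b + d)
  interchange = solve-∀

sumTo-*ˡ : ∀ n c (f : ℕ → ℕ) → sumTo n (λ k → c * f k) ≡ c * sumTo n f
sumTo-*ˡ zero    c f = sym (*-zeroʳ c)
sumTo-*ˡ (suc n) c f =
  trans (cong (_+ c * f (suc n)) (sumTo-*ˡ n c f)) (sym (*-distribˡ-+ c (sumTo n f) (f (suc n))))

sumTo-swap : ∀ n m (h : ℕ → ℕ → ℕ) →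
  sumTo n (λ k → sumTo m (h k)) ≡ sumTo m (λ d → sumTo n (λ k → h k d))
sumTo-swap zero    m h = sym (sumTo-zero m (λ _ _ _ → refl))
sumTo-swap (suc n) m h =
  trans (cong (_+ sumTo m (h (suc n))) (sumTo-swap n m h))
        (sym (sumTo-+ m (λ d → sumTo n (λ k → h k d)) (h (suc n))))

sumTo-single : ∀ n c {f : ℕ → ℕ} → 1 ≤ c → c ≤ n →
  (∀ k → 1 ≤ k → k ≤ n → k ≢ c → f k ≡ 0) → sumTo n f ≡ f c
sumTo-single zero    (suc _) _ () _
sumTo-single (suc n) c {f} 1≤c c≤n vanish with c ≟ suc n
... | yes refl =
  cong (_+ f (suc n)) (sumTo-zero n (λ k 1≤k k≤n → vanish k 1≤k (m≤n⇒m≤1+n k≤n) (<⇒≢ (s≤s k≤n))))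
... | no c≢n = begin
  sumTo n f + f (suc n) ≡⟨ cong₂ _+_ below (vanish (suc n) (s≤s z≤n) ≤-refl (≢-sym c≢n)) ⟩
  f c + 0               ≡⟨ +-identityʳ (f c) ⟩
  f c                   ∎
  where
  open ≡-Reasoning
  below : sumTo n f ≡ f c
  below = sumTo-single n c 1≤c (s≤s⁻¹ (≤∧≢⇒< c≤n c≢n))
            (λ k 1≤k k≤n → vanish k 1≤k (m≤n⇒m≤1+n k≤n))

sumTo-split : ∀ m r (f : ℕ → ℕ) → sumTo (m + r) f ≡ sumTo m f + sumTo r (λ i → f (m + i))
sumTo-split m zero    f = trans (cong (λ x → sumTo x f) (+-identityʳ m)) (sym (+-identityʳ _))
sumTo-split m (suc r) f rewrite +-suc m r | sumTo-split m r f = +-assoc (sumTo m f) _ _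

sumTo-truncate : ∀ n g {f : ℕ → ℕ} → g ≤ n → (∀ k → g < k → k ≤ n → f k ≡ 0) →
  sumTo n f ≡ sumTo g f
sumTo-truncate n g {f} g≤n vanish = begin
  sumTo n f                                         ≡⟨ cong (λ x → sumTo x f) (sym n≡g+r) ⟩
  sumTo (g + (n ∸ g)) f                             ≡⟨ sumTo-split g (n ∸ g) f ⟩
  sumTo g f + sumTo (n ∸ g) (λ i → f (g + i))       ≡⟨ cong (_+_ (sumTo g f)) (sumTo-zero (n ∸ g) tail) ⟩
  sumTo g f + 0                                     ≡⟨ +-identityʳ _ ⟩
  sumTo g f                                         ∎
  where
  open ≡-Reasoning
  n≡g+r : g + (n ∸ g) ≡ n
  n≡g+r = m+[n∸m]≡n g≤n
  tail : ∀ i → 1 ≤ i → i ≤ n ∸ g → f (g + i) ≡ 0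
  tail i 1≤i i≤r = vanish (g + i) (m<m+n g 1≤i) (subst (g + i ≤_) n≡g+r (+-monoʳ-≤ g i≤r))

sumTo-multiples : ∀ e d {f : ℕ → ℕ} → 1 ≤ e → (∀ k → ¬ (e ∣ k) → f k ≡ 0) →
  sumTo (e * d) f ≡ sumTo d (λ a → f (e * a))
sumTo-multiples e zero    {f} _   _      rewrite *-zeroʳ e = refl
sumTo-multiples e (suc d) {f} 1≤e vanish = begin
  sumTo (e * suc d) f                              ≡⟨ cong (λ x → sumTo x f) e[1+d] ⟩
  sumTo (e * d + e) f                              ≡⟨ sumTo-split (e * d) e f ⟩
  sumTo (e * d) f + sumTo e (λ i → f (e * d + i))  ≡⟨ cong₂ _+_ (sumTo-multiples e d 1≤e vanish) lastBlock ⟩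
  sumTo d (λ a → f (e * a)) + f (e * d + e)        ≡⟨ cong (λ x → sumTo d (λ a → f (e * a)) + f x) (sym e[1+d]) ⟩
  sumTo d (λ a → f (e * a)) + f (e * suc d)        ∎
  where
  open ≡-Reasoning
  e[1+d] : e * suc d ≡ e * d + e
  e[1+d] = trans (*-suc e d) (+-comm e (e * d))
  -- between e·d and e·(d+1) only the endpoint is a multiple of e
  lastBlock : sumTo e (λ i → f (e * d + i)) ≡ f (e * d + e)
  lastBlock = sumTo-single e e 1≤e ≤-refl (λ i 1≤i i≤e i≢e → vanish _ (not-multiple i 1≤i i≤e i≢e))
    where
    not-multiple : ∀ i → 1 ≤ i → i ≤ e → i ≢ e → ¬ (e ∣ e * d + i)
    not-multiple i@(suc _) _ i≤e i≢e e∣ = i≢e (≤-antisym i≤e (∣⇒≤ (∣m+n∣m⇒∣n e∣ (m∣m*n d))))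

[_]*_ : ∀ {P : Set} → Dec P → ℕ → ℕ
[ yes _ ]* x = x
[ no _  ]* x = 0

[]*-yes : ∀ {P : Set} (D : Dec P) x → P → [ D ]* x ≡ x
[]*-yes (yes _) x _ = refl
[]*-yes (no ¬p) x p = ⊥-elim (¬p p)

[]*-no : ∀ {P : Set} (D : Dec P) x → ¬ P → [ D ]* x ≡ 0
[]*-no (yes p) x ¬p = ⊥-elim (¬p p)
[]*-no (no _)  x _  = refl

[]*-cong : ∀ {P Q : Set} (D : Dec P) (E : Dec Q) → (P → Q) → (Q → P) → ∀ x → [ D ]* x ≡ [ E ]* x
[]*-cong (yes p) E P⇒Q Q⇒P x = sym ([]*-yes E x (P⇒Q p))
[]*-cong (no ¬p) E P⇒Q Q⇒P x = sym ([]*-no E x (λ q → ¬p (Q⇒P q)))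

[]*-factor : ∀ {P : Set} (D : Dec P) y → [ D ]* y ≡ y * [ D ]* 1
[]*-factor (yes _) y = sym (*-identityʳ y)
[]*-factor (no _)  y = sym (*-zeroʳ y)

count-multiples : ∀ g t → 1 ≤ g → sumTo (g * t) (λ k → [ g ∣? k ]* 1) ≡ t
count-multiples g t 1≤g = begin
  sumTo (g * t) (λ k → [ g ∣? k ]* 1)  ≡⟨ sumTo-multiples g t 1≤g (λ k → []*-no (g ∣? k) 1) ⟩
  sumTo t (λ a → [ g ∣? g * a ]* 1)    ≡⟨ sumTo-cong t (λ a _ _ → []*-yes (g ∣? g * a) 1 (m∣m*n a)) ⟩
  sumTo t (λ _ → 1)                    ≡⟨ sumTo-ones t ⟩
  t                                    ∎
  where open ≡-Reasoning

-- Gauss's identity Σ_{d ∣ m} φ(d) = m, proved by sorting 1 ≤ k ≤ m by gcd(k, m).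

φ-as-sum : ∀ k d → countCoprime k d ≡ sumTo k (λ a → [ coprime? a d ]* 1)
φ-as-sum zero    d = refl
φ-as-sum (suc k) d = cong₂ _+_ (φ-as-sum k d) (if-as-indicator (coprime? (suc k) d))
  where
  if-as-indicator : ∀ {P : Set} (D : Dec P) → (if ⌊ D ⌋ then 1 else 0) ≡ [ D ]* 1
  if-as-indicator (yes _) = refl
  if-as-indicator (no _)  = refl

gcd≥1 : ∀ k m → 1 ≤ m → 1 ≤ gcd k m
gcd≥1 k m 1≤m = n≢0⇒n>0 (gcd[m,n]≢0 k m (inj₂ (λ m≡0 → <⇒≢ 1≤m (sym m≡0))))

gcd-value-unique : ∀ m → 1 ≤ m → ∀ k → sumTo m (λ e → [ gcd k m ≟ e ]* 1) ≡ 1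
gcd-value-unique m@(suc _) 1≤m k =
  trans (sumTo-single m (gcd k m) (gcd≥1 k m 1≤m) (gcd[m,n]≤n k m)
          (λ e _ _ e≢g → []*-no (gcd k m ≟ e) 1 (λ g≡e → e≢g (sym g≡e))))
        ([]*-yes (gcd k m ≟ gcd k m) 1 refl)

-- #{k ≤ m : gcd(k, m) = e} = φ(m/e) when e ∣ m, and 0 otherwise; the right-hand
-- side writes this as Σ_{d · e = m} φ(d).
gcd-fibre-size : ∀ m → 1 ≤ m → ∀ e → 1 ≤ e →
  sumTo m (λ k → [ gcd k m ≟ e ]* 1) ≡ sumTo m (λ d → [ d * e ≟ m ]* φ d)
gcd-fibre-size m 1≤m e 1≤e with e ∣? m
... | no e∤m =
  trans (sumTo-zero m (λ k _ _ → []*-no (gcd k m ≟ e) 1 (λ g≡e → e∤m (subst (_∣ m) g≡e (gcd[m,n]∣n k m)))))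
        (sym (sumTo-zero m (λ d _ _ → []*-no (d * e ≟ m) (φ d) (λ de≡m → e∤m (divides d (sym de≡m))))))
... | yes (divides q m≡qe) = begin
  sumTo m (λ k → [ gcd k m ≟ e ]* 1)        ≡⟨ cong (λ x → sumTo x (λ k → [ gcd k m ≟ e ]* 1)) m≡eq ⟩
  sumTo (e * q) (λ k → [ gcd k m ≟ e ]* 1)  ≡⟨ sumTo-multiples e q 1≤e off-multiples ⟩
  sumTo q (λ a → [ gcd (e * a) m ≟ e ]* 1)  ≡⟨ sumTo-cong q (λ a _ _ → on-multiples a) ⟩
  sumTo q (λ a → [ coprime? a q ]* 1)       ≡⟨ sym (φ-as-sum q q) ⟩
  φ q                                       ≡⟨ sym ([]*-yes (q * e ≟ m) (φ q) (sym m≡qe)) ⟩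
  [ q * e ≟ m ]* φ q                        ≡⟨ sym (sumTo-single m q 1≤q q≤m other-cofactors) ⟩
  sumTo m (λ d → [ d * e ≟ m ]* φ d)        ∎
  where
  open ≡-Reasoning
  instance
    e≢0 : NonZero e
    e≢0 = >-nonZero 1≤e
  m≡eq : m ≡ e * q
  m≡eq = trans m≡qe (*-comm q e)
  1≤q : 1 ≤ q
  1≤q = cofactor≥1 q e 1≤m m≡qe
  q≤m : q ≤ m
  q≤m = subst (q ≤_) (sym m≡qe) (m≤m*n q e)
  off-multiples : ∀ k → ¬ (e ∣ k) → [ gcd k m ≟ e ]* 1 ≡ 0
  off-multiples k e∤k = []*-no (gcd k m ≟ e) 1 (λ g≡e → e∤k (subst (_∣ k) g≡e (gcd[m,n]∣m k m)))
  -- gcd(e·a, e·q) = e · gcd(a, q), which is e exactly when a is coprime to q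
  on-multiples : ∀ a → [ gcd (e * a) m ≟ e ]* 1 ≡ [ coprime? a q ]* 1
  on-multiples a = []*-cong (gcd (e * a) m ≟ e) (coprime? a q) to from 1
    where
    g≡ : gcd (e * a) m ≡ e * gcd a q
    g≡ = trans (cong (gcd (e * a)) m≡eq) (sym (c*gcd[m,n]≡gcd[cm,cn] e a q))
    to : gcd (e * a) m ≡ e → Coprime a q
    to g≡e = gcd≡1⇒coprime (*-cancelˡ-≡ (gcd a q) 1 e (trans (sym g≡) (trans g≡e (sym (*-identityʳ e)))))
    from : Coprime a q → gcd (e * a) m ≡ e
    from c = trans g≡ (trans (cong (e *_) (coprime⇒gcd≡1 c)) (*-identityʳ e))
  other-cofactors : ∀ d → 1 ≤ d → d ≤ m → d ≢ q → [ d * e ≟ m ]* φ d ≡ 0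
  other-cofactors d _ _ d≢q = []*-no (d * e ≟ m) (φ d) (λ de≡m → d≢q (*-cancelʳ-≡ d q e (trans de≡m m≡qe)))

complementary-divisor : ∀ m → 1 ≤ m → ∀ d → sumTo m (λ e → [ d * e ≟ m ]* φ d) ≡ [ d ∣? m ]* φ d
complementary-divisor m 1≤m d with d ∣? m
... | no d∤m =
  sumTo-zero m (λ e _ _ → []*-no (d * e ≟ m) (φ d) (λ de≡m → d∤m (divides e (trans (sym de≡m) (*-comm d e)))))
... | yes (divides q m≡qd) =
  trans (sumTo-single m q 1≤q q≤m other-cofactors) ([]*-yes (d * q ≟ m) (φ d) (trans (*-comm d q) (sym m≡qd)))
  where
  instance
    d≢0 : NonZero d
    d≢0 = >-nonZero (cofactor≥1 d q 1≤m (trans m≡qd (*-comm q d)))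
  1≤q : 1 ≤ q
  1≤q = cofactor≥1 q d 1≤m m≡qd
  q≤m : q ≤ m
  q≤m = subst (q ≤_) (sym m≡qd) (m≤m*n q d)
  other-cofactors : ∀ e → 1 ≤ e → e ≤ m → e ≢ q → [ d * e ≟ m ]* φ d ≡ 0
  other-cofactors e _ _ e≢q =
    []*-no (d * e ≟ m) (φ d) (λ de≡m → e≢q (*-cancelʳ-≡ e q d (trans (*-comm e d) (trans de≡m m≡qd))))

gauss : ∀ m → 1 ≤ m → sumTo m (λ d → [ d ∣? m ]* φ d) ≡ m
gauss m 1≤m = sym (begin
  m                                                      ≡⟨ sym (sumTo-ones m) ⟩
  sumTo m (λ _ → 1)                                      ≡⟨ sumTo-cong m (λ k _ _ → sym (gcd-value-unique m 1≤m k)) ⟩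
  sumTo m (λ k → sumTo m (λ e → [ gcd k m ≟ e ]* 1))     ≡⟨ sumTo-swap m m _ ⟩
  sumTo m (λ e → sumTo m (λ k → [ gcd k m ≟ e ]* 1))     ≡⟨ sumTo-cong m (λ e 1≤e _ → gcd-fibre-size m 1≤m e 1≤e) ⟩
  sumTo m (λ e → sumTo m (λ d → [ d * e ≟ m ]* φ d))     ≡⟨ sumTo-swap m m _ ⟩
  sumTo m (λ d → sumTo m (λ e → [ d * e ≟ m ]* φ d))     ≡⟨ sumTo-cong m (λ d _ _ → complementary-divisor m 1≤m d) ⟩
  sumTo m (λ d → [ d ∣? m ]* φ d)                        ∎)
  where open ≡-Reasoning

-- gcd(x, n) = Σ_{d ∣ n, d ∣ x} φ(d): Gauss's identity for gcd(x, n), whose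
-- divisors are the common divisors of x and n.
gcd-as-φ-sum : ∀ x n → 1 ≤ n → gcd x n ≡ sumTo n (λ d → [ d ∣? n ]* ([ d ∣? x ]* φ d))
gcd-as-φ-sum x n@(suc _) 1≤n = sym (begin
  sumTo n (λ d → [ d ∣? n ]* ([ d ∣? x ]* φ d))  ≡⟨ sumTo-cong n (λ d _ _ → common-divisor d) ⟩
  sumTo n (λ d → [ d ∣? g ]* φ d)               ≡⟨ sumTo-truncate n g (gcd[m,n]≤n x n) beyond-g ⟩
  sumTo g (λ d → [ d ∣? g ]* φ d)               ≡⟨ gauss g (gcd≥1 x n 1≤n) ⟩
  g                                             ∎)
  where
  open ≡-Reasoning
  g = gcd x n
  instance
    g≢0 : NonZero g
    g≢0 = >-nonZero (gcd≥1 x n 1≤n)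
  beyond-g : ∀ k → g < k → k ≤ n → [ k ∣? g ]* φ k ≡ 0
  beyond-g k g<k _ = []*-no (k ∣? g) (φ k) (λ k∣g → <⇒≱ g<k (∣⇒≤ k∣g))
  common-divisor : ∀ d → [ d ∣? n ]* ([ d ∣? x ]* φ d) ≡ [ d ∣? g ]* φ d
  common-divisor d with d ∣? n | d ∣? x
  ... | yes d∣n | yes d∣x = sym ([]*-yes (d ∣? g) (φ d) (gcd-greatest d∣x d∣n))
  ... | yes _   | no d∤x  = sym ([]*-no (d ∣? g) (φ d) (λ d∣g → d∤x (∣-trans d∣g (gcd[m,n]∣m x n))))
  ... | no d∤n  | _       = sym ([]*-no (d ∣? g) (φ d) (λ d∣g → d∤n (∣-trans d∣g (gcd[m,n]∣n x n))))

sum-gcd-powers : ∀ j n → 1 ≤ n →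
  sumTo n (λ k → gcd (k ^ j) n) ≡ sumTo n (λ d → [ d ∣? n ]* (φ d * sumTo n (λ k → [ d ∣? k ^ j ]* 1)))
sum-gcd-powers j n 1≤n = begin
  sumTo n (λ k → gcd (k ^ j) n)                                     ≡⟨ sumTo-cong n (λ k _ _ → gcd-as-φ-sum (k ^ j) n 1≤n) ⟩
  sumTo n (λ k → sumTo n (λ d → [ d ∣? n ]* ([ d ∣? k ^ j ]* φ d))) ≡⟨ sumTo-swap n n _ ⟩
  sumTo n (λ d → sumTo n (λ k → [ d ∣? n ]* ([ d ∣? k ^ j ]* φ d))) ≡⟨ sumTo-cong n (λ d _ _ → pull-out d) ⟩
  sumTo n (λ d → [ d ∣? n ]* (φ d * sumTo n (λ k → [ d ∣? k ^ j ]* 1))) ∎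
  where
  open ≡-Reasoning
  pull-out : ∀ d → sumTo n (λ k → [ d ∣? n ]* ([ d ∣? k ^ j ]* φ d))
                   ≡ [ d ∣? n ]* (φ d * sumTo n (λ k → [ d ∣? k ^ j ]* 1))
  pull-out d with d ∣? n
  ... | no _  = sumTo-zero n (λ _ _ _ → refl)
  ... | yes _ = trans (sumTo-cong n (λ k _ _ → []*-factor (d ∣? k ^ j) (φ d))) (sumTo-*ˡ n (φ d) _)

-- The exponents of N(p^a) and of the root modulus of p^a add up to a.

module _ (j : ℕ) .{{_ : NonZero j}} where

  floorExp : ℕ → ℕ
  floorExp a = ((j ∸ 1) * a) / j

  -- ⌈a/j⌉, characterised below as the least c with a ≤ c · j.
  rootExp : ℕ → ℕ
  rootExp a = a ∸ floorExp a

  private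
    [j-1]a≡aj-a : ∀ a → (j ∸ 1) * a ≡ a * j ∸ a
    [j-1]a≡aj-a a = trans (*-distribʳ-∸ a j 1) (cong₂ _∸_ (*-comm j a) (*-identityˡ a))

  floorExp≤ : ∀ a → floorExp a ≤ a
  floorExp≤ a = begin
    ((j ∸ 1) * a) / j  ≤⟨ /-monoˡ-≤ j (subst (_≤ a * j) (sym ([j-1]a≡aj-a a)) (m∸n≤m (a * j) a)) ⟩
    (a * j) / j        ≡⟨ m*n/n≡m a j ⟩
    a                  ∎
    where open ≤-Reasoning

  rootExp-sufficient : ∀ a → a ≤ rootExp a * j
  rootExp-sufficient a = begin
    a                           ≡⟨ sym (m∸[m∸n]≡n (m≤m*n a j)) ⟩
    a * j ∸ (a * j ∸ a)         ≤⟨ ∸-monoʳ-≤ (a * j) (subst (floorExp a * j ≤_) ([j-1]a≡aj-a a) (m/n*n≤m _ j)) ⟩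
    a * j ∸ floorExp a * j      ≡⟨ sym (*-distribʳ-∸ j a (floorExp a)) ⟩
    rootExp a * j               ∎
    where open ≤-Reasoning

  rootExp-least : ∀ a v → a ≤ v * j → rootExp a ≤ v
  rootExp-least a v a≤vj = begin
    a ∸ floorExp a                ≤⟨ ∸-monoˡ-≤ (floorExp a) (≤-trans (m≤n+m∸n a v) (+-monoʳ-≤ v a-v≤floor)) ⟩
    v + floorExp a ∸ floorExp a   ≡⟨ m+n∸n≡m v (floorExp a) ⟩
    v                             ∎
    where
    open ≤-Reasoning
    a-v≤floor : a ∸ v ≤ floorExp a
    a-v≤floor = begin
      a ∸ v                    ≡⟨ sym (m*n/n≡m (a ∸ v) j) ⟩
      ((a ∸ v) * j) / j        ≤⟨ /-monoˡ-≤ j (begin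
        (a ∸ v) * j              ≡⟨ *-distribʳ-∸ j a v ⟩
        a * j ∸ v * j            ≤⟨ ∸-monoʳ-≤ (a * j) a≤vj ⟩
        a * j ∸ a                ≡⟨ sym ([j-1]a≡aj-a a) ⟩
        (j ∸ 1) * a              ∎) ⟩
      floorExp a               ∎

prime≥2 : ∀ {p} → Prime p → 2 ≤ p
prime≥2 {p} pp = nonTrivial⇒n>1 p {{prime⇒nonTrivial pp}}

prime∤1 : ∀ {p} → Prime p → ¬ (p ∣ 1)
prime∤1 pp p∣1 = <⇒≢ (prime≥2 pp) (sym (∣1⇒≡1 p∣1))

^-distribʳ-* : ∀ x y n → (x * y) ^ n ≡ x ^ n * y ^ n
^-distribʳ-* x y zero    = refl
^-distribʳ-* x y (suc n) =
  trans (cong (x * y *_) (^-distribʳ-* x y n)) ([m*n]*[o*p]≡[m*o]*[n*p] x y (x ^ n) (y ^ n))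

^-monoʳ-∣ : ∀ p {c v} → c ≤ v → p ^ c ∣ p ^ v
^-monoʳ-∣ p {c} {v} c≤v =
  divides (p ^ (v ∸ c)) (trans (cong (p ^_) (sym (m∸n+n≡m c≤v))) (^-distribˡ-+-* p (v ∸ c) c))

prime∤^ : ∀ {p t} → Prime p → ¬ (p ∣ t) → ∀ n → ¬ (p ∣ t ^ n)
prime∤^ pp p∤t zero    = prime∤1 pp
prime∤^ {t = t} pp p∤t (suc n) p∣tⁿ⁺¹ with euclidsLemma t (t ^ n) pp p∣tⁿ⁺¹
... | inj₁ p∣t  = p∤t p∣t
... | inj₂ p∣tⁿ = prime∤^ pp p∤t n p∣tⁿ

prime^-coprime : ∀ {p m} → Prime p → ¬ (p ∣ m) → ∀ a → Coprime (p ^ a) m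
prime^-coprime pp p∤m zero (i∣1 , _) = ∣1⇒≡1 i∣1
prime^-coprime {p} pp p∤m (suc a) {i} (i∣pᵃ⁺¹ , i∣m) with prime⇒irreducible pp (gcd[m,n]∣n i p)
... | inj₂ gcd≡p = ⊥-elim (p∤m (∣-trans (subst (_∣ i) gcd≡p (gcd[m,n]∣m i p)) i∣m))
... | inj₁ gcd≡1 = prime^-coprime pp p∤m a (coprime-divisor (gcd≡1⇒coprime gcd≡1) i∣pᵃ⁺¹ , i∣m)

prime^-exponent≤ : ∀ {p s} → Prime p → ¬ (p ∣ s) → ∀ a b → p ^ a ∣ p ^ b * s → a ≤ b
prime^-exponent≤ pp p∤s zero b _ = z≤n
prime^-exponent≤ {p} {s} pp p∤s (suc a) zero pᵃ⁺¹∣s =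
  ⊥-elim (p∤s (∣-trans (m∣m*n (p ^ a)) (subst (p ^ suc a ∣_) (*-identityˡ s) pᵃ⁺¹∣s)))
prime^-exponent≤ {p} {s} pp p∤s (suc a) (suc b) ∣ =
  s≤s (prime^-exponent≤ pp p∤s a b (*-cancelˡ-∣ p {{prime⇒nonZero pp}} (subst (p * p ^ a ∣_) (*-assoc p (p ^ b) s) ∣)))

PrimePowerSplit : ℕ → ℕ → Set
PrimePowerSplit p m = Σ ℕ λ a → Σ ℕ λ t → m ≡ p ^ a * t × ¬ (p ∣ t)

primePowerSplit : ∀ {p} → Prime p → ∀ m → 1 ≤ m → PrimePowerSplit p m
primePowerSplit {p} pp = <-rec (λ m → 1 ≤ m → PrimePowerSplit p m) split
  where
  split : ∀ m → (∀ {m′} → m′ < m → 1 ≤ m′ → PrimePowerSplit p m′) → 1 ≤ m → PrimePowerSplit p m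
  split m rec 1≤m with p ∣? m
  ... | no p∤m = 0 , m , sym (*-identityˡ m) , p∤m
  ... | yes (divides q m≡qp) with rec q<m 1≤q
    where
    1≤q : 1 ≤ q
    1≤q = cofactor≥1 q p 1≤m m≡qp
    q<m : q < m
    q<m = subst (q <_) (sym m≡qp) (m<m*n q p {{>-nonZero 1≤q}} (prime≥2 pp))
  ... | a , t , q≡pᵃt , p∤t = suc a , t , trans m≡qp (trans (cong (_* p) q≡pᵃt) (rotate (p ^ a) t p)) , p∤t
    where
    rotate : ∀ x y z → x * y * z ≡ z * x * y
    rotate = solve-∀

primeDivisor : ∀ d → 2 ≤ d → Σ ℕ λ p → Prime p × p ∣ d
primeDivisor (suc zero) (s≤s ())
primeDivisor d@(suc (suc _)) _ with factorise d
... | record { factors = [] ; isFactorisation = () }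
... | record { factors = p ∷ ps ; isFactorisation = d≡ ; factorsPrime = pp ∷ _ } =
  p , pp , divides (product ps) (trans d≡ (*-comm p _))

-- Root moduli are multiplicative and known on prime powers.

IsRootModulus : ℕ → ℕ → ℕ → Set
IsRootModulus j d r = ∀ k → (d ∣ k ^ j → r ∣ k) × (r ∣ k → d ∣ k ^ j)

coprime-∣-* : ∀ {g h k} → Coprime g h → g ∣ k → h ∣ k → g * h ∣ k
coprime-∣-* {g} {h} g⊥h g∣k (divides w refl) =
  *-monoˡ-∣ h (coprime-divisor g⊥h (subst (g ∣_) (*-comm w h) g∣k))

rootModulus-* : ∀ {j d e g h} → Coprime d e → g ∣ d → h ∣ e →
  IsRootModulus j d g → IsRootModulus j e h → IsRootModulus j (d * e) (g * h)
rootModulus-* {j} {d} {e} {g} {h} d⊥e g∣d h∣e modᵈ modᵉ k = only-if , if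
  where
  g⊥h : Coprime g h
  g⊥h (i∣g , i∣h) = d⊥e (∣-trans i∣g g∣d , ∣-trans i∣h h∣e)
  only-if : d * e ∣ k ^ j → g * h ∣ k
  only-if de∣kʲ = coprime-∣-* g⊥h (proj₁ (modᵈ k) (m*n∣⇒m∣ d e de∣kʲ)) (proj₁ (modᵉ k) (m*n∣⇒n∣ d e de∣kʲ))
  if : g * h ∣ k → d * e ∣ k ^ j
  if gh∣k = coprime-∣-* d⊥e (proj₂ (modᵈ k) (m*n∣⇒m∣ g h gh∣k)) (proj₂ (modᵉ k) (m*n∣⇒n∣ g h gh∣k))

-- p^⌈a/j⌉ is the j-th root modulus of p^a: p^a ∣ k^j iff v_p(k) · j ≥ a.
rootModulus-prime^ : ∀ j .{{_ : NonZero j}} {p} → Prime p → ∀ a → IsRootModulus j (p ^ a) (p ^ rootExp j a)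
rootModulus-prime^ j {p} pp a k = only-if k , if k
  where
  c = rootExp j a
  only-if : ∀ k → p ^ a ∣ k ^ j → p ^ c ∣ k
  only-if zero _ = (p ^ c) ∣0
  only-if k@(suc _) pᵃ∣kʲ with primePowerSplit pp k (s≤s z≤n)
  ... | v , t , k≡pᵛt , p∤t = subst (p ^ c ∣_) (sym k≡pᵛt) (∣m⇒∣m*n t (^-monoʳ-∣ p c≤v))
    where
    kʲ≡ : k ^ j ≡ p ^ (v * j) * t ^ j
    kʲ≡ = trans (cong (_^ j) k≡pᵛt) (trans (^-distribʳ-* (p ^ v) t j) (cong (_* t ^ j) (^-*-assoc p v j)))
    c≤v : c ≤ v
    c≤v = rootExp-least j a v (prime^-exponent≤ pp (prime∤^ pp p∤t j) a (v * j) (subst (p ^ a ∣_) kʲ≡ pᵃ∣kʲ))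
  if : ∀ k → p ^ c ∣ k → p ^ a ∣ k ^ j
  if k (divides u refl) = subst (p ^ a ∣_) (sym kʲ≡) (∣n⇒∣m*n (u ^ j) (^-monoʳ-∣ p (rootExp-sufficient j a)))
    where
    kʲ≡ : (u * p ^ c) ^ j ≡ u ^ j * p ^ (c * j)
    kʲ≡ = trans (^-distribʳ-* u (p ^ c) j) (cong (u ^ j *_) (^-*-assoc p c j))

module _ (j : ℕ) .{{_ : NonZero j}} (N : ℕ → ℕ) (N-mult : IsMultiplicative N)
         (N-prime^ : ∀ p a → Prime p → 1 ≤ a → N (p ^ a) ≡ p ^ (((j ∸ 1) * a) / j)) where

  RootFactor : ℕ → Set
  RootFactor d = Σ ℕ λ r → r * N d ≡ d × IsRootModulus j d r

  rootFactor-prime^ : ∀ {p} → Prime p → ∀ a → 1 ≤ a → RootFactor (p ^ a)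
  rootFactor-prime^ {p} pp a 1≤a = p ^ rootExp j a , exponents-add , rootModulus-prime^ j pp a
    where
    exponents-add : p ^ rootExp j a * N (p ^ a) ≡ p ^ a
    exponents-add = trans (cong (p ^ rootExp j a *_) (N-prime^ p a pp 1≤a))
      (trans (sym (^-distribˡ-+-* p (rootExp j a) (floorExp j a))) (cong (p ^_) (m∸n+n≡m (floorExp≤ j a))))

  rootFactor-* : ∀ {d e} → Coprime d e → 1 ≤ d → 1 ≤ e → RootFactor d → RootFactor e → RootFactor (d * e)
  rootFactor-* {d} {e} d⊥e 1≤d 1≤e (g , gN≡d , modᵈ) (h , hN≡e , modᵉ) =
    g * h , ghN≡de , rootModulus-* {j} d⊥e (factor∣ gN≡d) (factor∣ hN≡e) modᵈ modᵉ
    where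
    factor∣ : ∀ {r m} → r * N m ≡ m → r ∣ m
    factor∣ {r} {m} rN≡m = divides (N m) (trans (sym rN≡m) (*-comm r (N m)))
    ghN≡de : g * h * N (d * e) ≡ d * e
    ghN≡de = trans (cong (g * h *_) (proj₂ N-mult d e 1≤d 1≤e d⊥e))
               (trans ([m*n]*[o*p]≡[m*o]*[n*p] g h (N d) (N e)) (cong₂ _*_ gN≡d hN≡e))

  -- Strong induction on d: split off the full power of a prime divisor.
  rootFactor : ∀ d → 1 ≤ d → RootFactor d
  rootFactor = <-rec (λ d → 1 ≤ d → RootFactor d) step
    where
    step : ∀ d → (∀ {e} → e < d → 1 ≤ e → RootFactor e) → 1 ≤ d → RootFactor d
    step (suc zero) _ _ = 1 , trans (*-identityˡ (N 1)) (proj₁ N-mult) , λ k → (λ _ → 1∣ k) , (λ _ → 1∣ (k ^ j))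
    step d@(suc (suc _)) rec _ with primeDivisor d (s≤s (s≤s z≤n))
    ... | p , pp , p∣d with primePowerSplit pp d (s≤s z≤n)
    ...   | zero  , t , d≡t , p∤t = ⊥-elim (p∤t (subst (p ∣_) (trans d≡t (*-identityˡ t)) p∣d))
    ...   | suc a , t , d≡pᵃt , p∤t =
      subst RootFactor (sym d≡pᵃt)
        (rootFactor-* (prime^-coprime pp p∤t (suc a)) (m^n>0 p {{prime⇒nonZero pp}} (suc a)) 1≤t
          (rootFactor-prime^ pp (suc a) (s≤s z≤n)) (rec t<d 1≤t))
      where
      1≤t : 1 ≤ t
      1≤t = cofactor≥1 t (p ^ suc a) (s≤s z≤n) (trans d≡pᵃt (*-comm (p ^ suc a) t))
      1<pᵃ⁺¹ : 1 < p ^ suc a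
      1<pᵃ⁺¹ = ≤-trans (prime≥2 pp) (m≤m*n p (p ^ a) {{m^n≢0 p a {{prime⇒nonZero pp}}}})
      t<d : t < d
      t<d = subst (t <_) (trans (*-comm t (p ^ suc a)) (sym d≡pᵃt)) (m<m*n t (p ^ suc a) {{>-nonZero 1≤t}} 1<pᵃ⁺¹)

  count-power-multiples : ∀ d q n → 1 ≤ d → n ≡ q * d → sumTo n (λ k → [ d ∣? k ^ j ]* 1) ≡ N d * q
  count-power-multiples d q n 1≤d n≡qd with rootFactor d 1≤d
  ... | r , rN≡d , modᵈ = begin
    sumTo n (λ k → [ d ∣? k ^ j ]* 1)        ≡⟨ sumTo-cong n (λ k _ _ → same-indicator k) ⟩
    sumTo n (λ k → [ r ∣? k ]* 1)            ≡⟨ cong (λ x → sumTo x (λ k → [ r ∣? k ]* 1)) n≡r[Nq] ⟩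
    sumTo (r * (N d * q)) (λ k → [ r ∣? k ]* 1) ≡⟨ count-multiples r (N d * q) (cofactor≥1 r (N d) 1≤d (sym rN≡d)) ⟩
    N d * q                                  ∎
    where
    open ≡-Reasoning
    same-indicator : ∀ k → [ d ∣? k ^ j ]* 1 ≡ [ r ∣? k ]* 1
    same-indicator k = []*-cong (d ∣? k ^ j) (r ∣? k) (proj₁ (modᵈ k)) (proj₂ (modᵈ k)) 1
    n≡r[Nq] : n ≡ r * (N d * q)
    n≡r[Nq] = trans n≡qd (trans (*-comm q d) (trans (cong (_* q) (sym rN≡d)) (*-assoc r (N d) q)))

toℚ : ℕ → ℚ
toℚ a = (+ a) ℚ./ 1

private
  toℚᵘ-/ : ∀ i m → toℚᵘ (i ℚ./ suc m) ℚᵘ.≃ mkℚᵘ i m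
  toℚᵘ-/ i m = ℚ.toℚᵘ-fromℚᵘ (mkℚᵘ i m)

toℚ-+ : ∀ a b → toℚ a ℚ.+ toℚ b ≡ toℚ (a + b)
toℚ-+ a b = ℚ.toℚᵘ-injective (begin
  toℚᵘ (toℚ a ℚ.+ toℚ b)             ≈⟨ ℚ.toℚᵘ-homo-+ (toℚ a) (toℚ b) ⟩
  toℚᵘ (toℚ a) ℚᵘ.+ toℚᵘ (toℚ b)     ≈⟨ ℚᵘ.+-cong (toℚᵘ-/ (+ a) 0) (toℚᵘ-/ (+ b) 0) ⟩
  mkℚᵘ (+ a) 0 ℚᵘ.+ mkℚᵘ (+ b) 0     ≈⟨ *≡* (trans (add-over-1 (+ a) (+ b)) (cong (ℤ._* + 1) (sym (ℤ.pos-+ a b)))) ⟩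
  mkℚᵘ (+ (a + b)) 0                 ≈⟨ ℚᵘ.≃-sym (toℚᵘ-/ (+ (a + b)) 0) ⟩
  toℚᵘ (toℚ (a + b))                 ∎)
  where
  open ℚᵘ.≃-Reasoning
  add-over-1 : ∀ x y → (x ℤ.* + 1 ℤ.+ y ℤ.* + 1) ℤ.* + 1 ≡ (x ℤ.+ y) ℤ.* + 1
  add-over-1 = ℤ-Solver.solve-∀

private
  -- a · n = (a · q) · d, written with the denominators of mkℚᵘ
  cross-multiply : ∀ a q d′ n′ → suc n′ ≡ q * suc d′ →
    + a ℤ.* + suc (n′ * 1) ≡ (+ 1 ℤ.* + (a * q)) ℤ.* + suc d′
  cross-multiply a q d′ n′ n≡qd = begin
    + a ℤ.* + suc (n′ * 1)            ≡⟨ sym (ℤ.pos-* a (suc (n′ * 1))) ⟩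
    + (a * suc (n′ * 1))              ≡⟨ cong (λ z → + (a * suc z)) (*-identityʳ n′) ⟩
    + (a * suc n′)                    ≡⟨ cong (λ z → + (a * z)) n≡qd ⟩
    + (a * (q * suc d′))              ≡⟨ cong +_ (sym (*-assoc a q (suc d′))) ⟩
    + (a * q * suc d′)                ≡⟨ ℤ.pos-* (a * q) (suc d′) ⟩
    + (a * q) ℤ.* + suc d′            ≡⟨ cong (ℤ._* + suc d′) (sym (ℤ.*-identityˡ (+ (a * q)))) ⟩
    (+ 1 ℤ.* + (a * q)) ℤ.* + suc d′  ∎
    where open ≡-Reasoning

/-as-scaled : ∀ a d q n .{{_ : NonZero d}} .{{_ : NonZero n}} → n ≡ q * d →
  (+ a) ℚ./ d ≡ ((+ 1) ℚ./ n) ℚ.* toℚ (a * q)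
/-as-scaled a (suc d′) q (suc n′) n≡qd = ℚ.toℚᵘ-injective (begin
  toℚᵘ ((+ a) ℚ./ suc d′)                               ≈⟨ toℚᵘ-/ (+ a) d′ ⟩
  mkℚᵘ (+ a) d′                                         ≈⟨ *≡* (cross-multiply a q d′ n′ n≡qd) ⟩
  mkℚᵘ (+ 1) n′ ℚᵘ.* mkℚᵘ (+ (a * q)) 0                 ≈⟨ ℚᵘ.*-cong (toℚᵘ-/ (+ 1) n′) (toℚᵘ-/ (+ (a * q)) 0) ⟨
  toℚᵘ ((+ 1) ℚ./ suc n′) ℚᵘ.* toℚᵘ (toℚ (a * q))       ≈⟨ ℚ.toℚᵘ-homo-* ((+ 1) ℚ./ suc n′) (toℚ (a * q)) ⟨
  toℚᵘ (((+ 1) ℚ./ suc n′) ℚ.* toℚ (a * q))             ∎)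
  where
  open ℚᵘ.≃-Reasoning

Σ[1‥]-cong : ∀ n {F G : (k : ℕ) → .{{NonZero k}} → ℚ} → (∀ k .{{_ : NonZero k}} → F k ≡ G k) →
  Σ[1‥ n ] F ≡ Σ[1‥ n ] G
Σ[1‥]-cong zero    eq = refl
Σ[1‥]-cong (suc n) eq = cong₂ ℚ._+_ (Σ[1‥]-cong n eq) (eq (suc n))

Σ[1‥]-toℚ : ∀ n (f : ℕ → ℕ) → Σ[1‥ n ] (λ k → toℚ (f k)) ≡ toℚ (sumTo n f)
Σ[1‥]-toℚ zero    f = refl
Σ[1‥]-toℚ (suc n) f = trans (cong (ℚ._+ toℚ (f (suc n))) (Σ[1‥]-toℚ n f)) (toℚ-+ (sumTo n f) (f (suc n)))

Σ[1‥]-*ˡ : ∀ n c (G : ℕ → ℚ) → Σ[1‥ n ] (λ k → c ℚ.* G k) ≡ c ℚ.* Σ[1‥ n ] (λ k → G k)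
Σ[1‥]-*ˡ zero    c G = sym (ℚ.*-zeroʳ c)
Σ[1‥]-*ˡ (suc n) c G = trans (cong (ℚ._+ (c ℚ.* G (suc n))) (Σ[1‥]-*ˡ n c G)) (sym (ℚ.*-distribˡ-+ c _ _))


corollary13 : (j : ℕ) → .{{_ : NonZero j}} → (N : ℕ → ℕ) → IsMultiplicative N →
    (∀ p a → Prime p → 1 ≤ a → N (p ^ a) ≡ p ^ (((j ∸ 1) * a) / j)) →
    (n : ℕ) → .{{_ : NonZero n}} →
    ((+ 1) ℚ./ n) ℚ.* Σ[1‥ n ] (λ k → (+ gcd (k ^ j) n) ℚ./ 1)
      ≡ Σ-divisors n (λ d → (+ (φ d * N d)) ℚ./ d)
corollary13 j N N-mult N-prime^ n = begin
  c ℚ.* Σ[1‥ n ] (λ k → toℚ (gcd (k ^ j) n))  ≡⟨ cong (c ℚ.*_) (Σ[1‥]-toℚ n (λ k → gcd (k ^ j) n)) ⟩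
  c ℚ.* toℚ (sumTo n (λ k → gcd (k ^ j) n))    ≡⟨ cong (λ z → c ℚ.* toℚ z) (sum-gcd-powers j n 1≤n) ⟩
  c ℚ.* toℚ (sumTo n term)                    ≡⟨ cong (c ℚ.*_) (sym (Σ[1‥]-toℚ n term)) ⟩
  c ℚ.* Σ[1‥ n ] (λ d → toℚ (term d))         ≡⟨ sym (Σ[1‥]-*ˡ n c (λ d → toℚ (term d))) ⟩
  Σ[1‥ n ] (λ d → c ℚ.* toℚ (term d))         ≡⟨ Σ[1‥]-cong n (λ d → sym (divisor-term d)) ⟩
  Σ-divisors n (λ d → (+ (φ d * N d)) ℚ./ d)  ∎
  where
  open ≡-Reasoning
  c = (+ 1) ℚ./ n
  1≤n = >-nonZero⁻¹ n
  term : ℕ → ℕ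
  term d = [ d ∣? n ]* (φ d * sumTo n (λ k → [ d ∣? k ^ j ]* 1))
  divisor-term : ∀ d .{{_ : NonZero d}} →
    (if ⌊ d ∣? n ⌋ then (+ (φ d * N d)) ℚ./ d else 0ℚ) ≡ c ℚ.* toℚ (term d)
  divisor-term d with d ∣? n
  ... | no _ = sym (ℚ.*-zeroʳ c)
  ... | yes (divides q n≡qd) = trans (/-as-scaled (φ d * N d) d q n n≡qd)
    (cong (λ z → c ℚ.* toℚ z) (trans (*-assoc (φ d) (N d) q)
      (cong (φ d *_) (sym (count-power-multiples j N N-mult N-prime^ d q n (>-nonZero⁻¹ d) n≡qd)))))
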